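{- Let $G$ be a graph with maximum degree $d$, and let $I$ be an independent set selected uniformly at random from the set of all independent sets of $G$ (including the empty set). For all $v\in V(G)$ it holds that $\Pr[v\in I]\ge 1/2^{d+1}$. -}

module Defs where

open import Data.Bool using (Bool; true; false; _∧_; not)
open import Data.Nat using (ℕ; zero; suc)
open import Data.Fin using (Fin)
open import Data.Vec using (Vec; []; _∷_; lookup)
open import Data.List using (List; []; _∷_; map; _++_; length; filterᵇ; allFin)
open import Relation.Binary.PropositionalEquality using (_≡_)
open import Data.Product using (_×_; ∃)

record Graph (n : ℕ) : Set where
  field
    adj   : Fin n → Fin n → Bool
    sym   : ∀ u v → adj u v ≡ adj v u
    irrefl : ∀ v → adj v v ≡ false
open Graph public

degree : ∀ {n} → Graph n → Fin n → ℕ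
degree {n} G v = length (filterᵇ (adj G v) (allFin n))

open import Data.Nat using (_≤_)
HasMaxDegree : ∀ {n} → Graph n → ℕ → Set
HasMaxDegree G d = (∀ v → degree G v ≤ d) × ∃ (λ v → degree G v ≡ d)

-- a vertex subset is a Boolean vector (membership of vertex i is lookup S i)
-- list of all 2^n subsets of Fin n
allSubsets : (n : ℕ) → List (Vec Bool n)
allSubsets zero = [] ∷ []
allSubsets (suc n) = map (false ∷_) (allSubsets n) ++ map (true ∷_) (allSubsets n)

allᵇ : ∀ {A : Set} → (A → Bool) → List A → Bool
allᵇ p [] = true
allᵇ p (x ∷ xs) = p x ∧ allᵇ p xs

isIndependent : ∀ {n} → Graph n → Vec Bool n → Bool
isIndependent {n} G S =
  allᵇ (λ u → allᵇ (λ v → not (lookup S u ∧ lookup S v ∧ adj G u v)) (allFin n)) (allFin n)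

independentSets : ∀ {n} → Graph n → List (Vec Bool n)
independentSets {n} G = filterᵇ (isIndependent G) (allSubsets n)

numIndep : ∀ {n} → Graph n → ℕ
numIndep G = length (independentSets G)

numIndepContaining : ∀ {n} → Graph n → Fin n → ℕ
numIndepContaining G v = length (filterᵇ (λ S → lookup S v) (independentSets G))

-- Independent sets form a downward-closed family of vertex subsets. In any downward-closed
-- family, deleting a vertex u maps the members containing u injectively to members avoiding u,
-- so excluding u costs at most a factor 2. Excluding the d + 1 vertices of the closed
-- neighbourhood of v one at a time therefore costs at most 2^(d+1), and adding v to an
-- independent set that avoids its closed neighbourhood is an injection into the independent
-- sets containing v.
module Submission where

open import Defs hiding (sym)
open import Data.Bool using (Bool; true; false; _∧_; not; T)
open import Data.Bool.Properties using (T-∧; ∧-assoc; ∧-comm)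
open import Data.Unit using (tt)
open import Data.Nat using (ℕ; suc; _+_; _*_; _^_; _≤_; z≤n; s≤s)
open import Data.Nat.Properties
  using (≤-reflexive; m≤n⇒m≤1+n; +-suc; +-identityʳ; +-monoʳ-≤; *-monoʳ-≤; *-mono-≤; ^-monoʳ-≤; *-assoc; *-comm; module ≤-Reasoning)
open import Data.Fin using (Fin; zero; suc; _≟_)
open import Data.Vec using (Vec; _∷_; lookup; _[_]≔_)
open import Data.Vec.Properties using (lookup∘update; lookup∘update′)
open import Data.List using (List; []; _∷_; map; _++_; length; filterᵇ; allFin)
open import Data.List.Properties using (filter-++; length-++)
open import Data.List.Membership.Propositional using (_∈_)
open import Data.List.Membership.Propositional.Properties using (∈-allFin; ∈-filter⁺)
open import Data.List.Relation.Unary.Any using (here; there)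
open import Data.Product using (_,_; proj₁; proj₂) renaming (map to ×-map)
open import Function using (_∘_; id; Equivalence)
open import Relation.Binary.PropositionalEquality using (_≡_; refl; sym; trans; cong; cong₂; subst; module ≡-Reasoning)
open import Relation.Nullary using (yes; no)
open import Relation.Nullary.Decidable using (T?)

T-∧-mono : ∀ {a a′ b b′} → (T a → T a′) → (T b → T b′) → T (a ∧ b) → T (a′ ∧ b′)
T-∧-mono f g = Equivalence.from T-∧ ∘ ×-map f g ∘ Equivalence.to T-∧

T-not-antitone : ∀ {a b} → (T a → T b) → T (not b) → T (not a)
T-not-antitone {false} _ _ = tt
T-not-antitone {true} {false} a⇒b _ = a⇒b tt

allᵇ-mono : ∀ {A : Set} {p q : A → Bool} → (∀ x → T (p x) → T (q x)) →
            ∀ xs → T (allᵇ p xs) → T (allᵇ q xs)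
allᵇ-mono p⇒q [] _ = tt
allᵇ-mono p⇒q (x ∷ xs) = T-∧-mono (p⇒q x) (allᵇ-mono p⇒q xs)

T-allᵇ⁺ : ∀ {A : Set} {p : A → Bool} → (∀ x → T (p x)) → ∀ xs → T (allᵇ p xs)
T-allᵇ⁺ px [] = tt
T-allᵇ⁺ px (x ∷ xs) = Equivalence.from T-∧ (px x , T-allᵇ⁺ px xs)

T-allᵇ⁻ : ∀ {A : Set} {p : A → Bool} {x xs} → T (allᵇ p xs) → x ∈ xs → T (p x)
T-allᵇ⁻ {xs = y ∷ ys} all-p (here refl)  = proj₁ (Equivalence.to T-∧ all-p)
T-allᵇ⁻ {xs = y ∷ ys} all-p (there x∈ys) = T-allᵇ⁻ (proj₂ (Equivalence.to T-∧ all-p)) x∈ys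

count : ∀ {A : Set} → (A → Bool) → List A → ℕ
count p xs = length (filterᵇ p xs)

count-mono : ∀ {A : Set} {p q : A → Bool} → (∀ x → T (p x) → T (q x)) →
             ∀ xs → count p xs ≤ count q xs
count-mono p⇒q [] = z≤n
count-mono {p = p} {q} p⇒q (x ∷ xs) with p x | q x | p⇒q x
... | false | false | _ = count-mono p⇒q xs
... | false | true  | _ = m≤n⇒m≤1+n (count-mono p⇒q xs)
... | true  | true  | _ = s≤s (count-mono p⇒q xs)
... | true  | false | px⇒qx with () ← px⇒qx tt

count-cong : ∀ {A : Set} {p q : A → Bool} → (∀ x → p x ≡ q x) →
             ∀ xs → count p xs ≡ count q xs
count-cong p≗q [] = refl
count-cong {q = q} p≗q (x ∷ xs) rewrite p≗q x with q x
... | false = count-cong p≗q xs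
... | true  = cong suc (count-cong p≗q xs)

count-const-false : ∀ {A : Set} (xs : List A) → count (λ _ → false) xs ≡ 0
count-const-false [] = refl
count-const-false (x ∷ xs) = count-const-false xs

count-++ : ∀ {A : Set} (p : A → Bool) xs ys → count p (xs ++ ys) ≡ count p xs + count p ys
count-++ p xs ys = trans (cong length (filter-++ (T? ∘ p) xs ys)) (length-++ (filterᵇ p xs))

count-map : ∀ {A B : Set} (p : B → Bool) (f : A → B) xs → count p (map f xs) ≡ count (p ∘ f) xs
count-map p f [] = refl
count-map p f (x ∷ xs) with p (f x)
... | false = count-map p f xs
... | true  = cong suc (count-map p f xs)

count-filterᵇ : ∀ {A : Set} (p q : A → Bool) xs →
                count q (filterᵇ p xs) ≡ count (λ x → p x ∧ q x) xs
count-filterᵇ p q [] = refl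
count-filterᵇ p q (x ∷ xs) with p x
... | false = count-filterᵇ p q xs
... | true with q x
...   | false = count-filterᵇ p q xs
...   | true  = cong suc (count-filterᵇ p q xs)

count-partition : ∀ {A : Set} (q p : A → Bool) xs →
                  count p xs ≡ count (λ x → not (q x) ∧ p x) xs + count (λ x → q x ∧ p x) xs
count-partition q p [] = refl
count-partition q p (x ∷ xs) with q x | p x
... | false | false = count-partition q p xs
... | false | true  = cong suc (count-partition q p xs)
... | true  | false = count-partition q p xs
... | true  | true  = trans (cong suc (count-partition q p xs)) (sym (+-suc _ _))

count-allSubsets-suc : ∀ n (p : Vec Bool (suc n) → Bool) →
                       count p (allSubsets (suc n)) ≡
                       count (λ S → p (false ∷ S)) (allSubsets n) + count (λ S → p (true ∷ S)) (allSubsets n)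
count-allSubsets-suc n p =
  trans (count-++ p (map (false ∷_) (allSubsets n)) _)
        (cong₂ _+_ (count-map p (false ∷_) (allSubsets n)) (count-map p (true ∷_) (allSubsets n)))

-- Removing u is a bijection from the subsets containing u onto those avoiding it.
count-∋≡count-∌-insert : ∀ n (u : Fin n) (P : Vec Bool n → Bool) →
                         count (λ S → lookup S u ∧ P S) (allSubsets n) ≡
                         count (λ S → not (lookup S u) ∧ P (S [ u ]≔ true)) (allSubsets n)
count-∋≡count-∌-insert (suc n) zero P = begin
  count (λ S → lookup S zero ∧ P S) (allSubsets (suc n))
    ≡⟨ count-allSubsets-suc n _ ⟩
  count (λ _ → false) subsets + c
    ≡⟨ cong (_+ c) (count-const-false subsets) ⟩
  c
    ≡⟨ sym (+-identityʳ c) ⟩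
  c + 0
    ≡⟨ cong (c +_) (sym (count-const-false subsets)) ⟩
  c + count (λ _ → false) subsets
    ≡⟨ sym (count-allSubsets-suc n _) ⟩
  count (λ S → not (lookup S zero) ∧ P (S [ zero ]≔ true)) (allSubsets (suc n)) ∎
  where
  open ≡-Reasoning
  subsets : List (Vec Bool n)
  subsets = allSubsets n
  c : ℕ
  c = count (λ S → P (true ∷ S)) subsets
count-∋≡count-∌-insert (suc n) (suc u) P =
  trans (count-allSubsets-suc n _)
        (trans (cong₂ _+_ (count-∋≡count-∌-insert n u (P ∘ (false ∷_)))
                          (count-∋≡count-∌-insert n u (P ∘ (true ∷_))))
               (sym (count-allSubsets-suc n _)))

infix 4 _⊆_
_⊆_ : ∀ {n} → Vec Bool n → Vec Bool n → Set
S ⊆ S′ = ∀ i → T (lookup S i) → T (lookup S′ i)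

⊆-insert : ∀ {n} (S : Vec Bool n) u → S ⊆ S [ u ]≔ true
⊆-insert S u i i∈S with i ≟ u
... | yes refl rewrite lookup∘update i S true = tt
... | no i≢u   rewrite lookup∘update′ i≢u S true = i∈S

DownwardClosed : ∀ {n} → (Vec Bool n → Bool) → Set
DownwardClosed P = ∀ S S′ → S ⊆ S′ → T (P S′) → T (P S)

∧-downwardClosed : ∀ {n} {P Q : Vec Bool n → Bool} →
                   DownwardClosed P → DownwardClosed Q → DownwardClosed (λ S → P S ∧ Q S)
∧-downwardClosed P↓ Q↓ S S′ S⊆S′ = T-∧-mono (P↓ S S′ S⊆S′) (Q↓ S S′ S⊆S′)

Avoids : ∀ {n} → List (Fin n) → Vec Bool n → Bool
Avoids us S = allᵇ (λ u → not (lookup S u)) us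

Avoids-downwardClosed : ∀ {n} (us : List (Fin n)) → DownwardClosed (Avoids us)
Avoids-downwardClosed us S S′ S⊆S′ = allᵇ-mono (λ u → T-not-antitone (S⊆S′ u)) us

count-downwardClosed-halving : ∀ {n} {P : Vec Bool n → Bool} → DownwardClosed P → ∀ u →
  count P (allSubsets n) ≤ 2 * count (λ S → not (lookup S u) ∧ P S) (allSubsets n)
count-downwardClosed-halving {n} {P} P↓ u = begin
  count P subsets                            ≡⟨ count-partition (λ S → lookup S u) P subsets ⟩
  c + count (λ S → lookup S u ∧ P S) subsets ≡⟨ cong (c +_) (count-∋≡count-∌-insert n u P) ⟩
  c + count (λ S → not (lookup S u) ∧ P (S [ u ]≔ true)) subsets
    ≤⟨ +-monoʳ-≤ c (count-mono (λ S → T-∧-mono id (P↓ S _ (⊆-insert S u))) subsets) ⟩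
  c + c                                      ≡⟨ cong (c +_) (sym (+-identityʳ c)) ⟩
  2 * c                                      ∎
  where
  open ≤-Reasoning
  subsets : List (Vec Bool n)
  subsets = allSubsets n
  c : ℕ
  c = count (λ S → not (lookup S u) ∧ P S) subsets

count-downwardClosed-avoiding : ∀ {n} {P : Vec Bool n → Bool} → DownwardClosed P → ∀ us →
  count P (allSubsets n) ≤ 2 ^ length us * count (λ S → Avoids us S ∧ P S) (allSubsets n)
count-downwardClosed-avoiding P↓ [] = ≤-reflexive (sym (+-identityʳ _))
count-downwardClosed-avoiding {n} {P} P↓ (u ∷ us) = begin
  count P subsets
    ≤⟨ count-downwardClosed-avoiding P↓ us ⟩
  2 ^ m * count (λ S → Avoids us S ∧ P S) subsets
    ≤⟨ *-monoʳ-≤ (2 ^ m) (count-downwardClosed-halving avoiding↓ u) ⟩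
  2 ^ m * (2 * count (λ S → not (lookup S u) ∧ (Avoids us S ∧ P S)) subsets)
    ≡⟨ cong (λ k → 2 ^ m * (2 * k)) (count-cong (λ S → sym (∧-assoc (not (lookup S u)) _ _)) subsets) ⟩
  2 ^ m * (2 * c)
    ≡⟨ sym (*-assoc (2 ^ m) 2 c) ⟩
  2 ^ m * 2 * c
    ≡⟨ cong (_* c) (*-comm (2 ^ m) 2) ⟩
  2 ^ suc m * c ∎
  where
  open ≤-Reasoning
  m : ℕ
  m = length us
  subsets : List (Vec Bool n)
  subsets = allSubsets n
  c : ℕ
  c = count (λ S → Avoids (u ∷ us) S ∧ P S) subsets
  avoiding↓ : DownwardClosed (λ S → Avoids us S ∧ P S)
  avoiding↓ = ∧-downwardClosed (Avoids-downwardClosed us) P↓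

neighbours : ∀ {n} → Graph n → Fin n → List (Fin n)
neighbours {n} G v = filterᵇ (adj G v) (allFin n)

isIndependent⁺ : ∀ {n} (G : Graph n) (S : Vec Bool n) →
                 (∀ u w → T (not (lookup S u ∧ lookup S w ∧ adj G u w))) → T (isIndependent G S)
isIndependent⁺ {n} G S independent = T-allᵇ⁺ (λ u → T-allᵇ⁺ (independent u) (allFin n)) (allFin n)

isIndependent⁻ : ∀ {n} (G : Graph n) (S : Vec Bool n) →
                 T (isIndependent G S) → ∀ u w → T (not (lookup S u ∧ lookup S w ∧ adj G u w))
isIndependent⁻ G S independent u w = T-allᵇ⁻ (T-allᵇ⁻ independent (∈-allFin u)) (∈-allFin w)

isIndependent-downwardClosed : ∀ {n} (G : Graph n) → DownwardClosed (isIndependent G)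
isIndependent-downwardClosed {n} G S S′ S⊆S′ =
  allᵇ-mono (λ u → allᵇ-mono (λ w → T-not-antitone (T-∧-mono (S⊆S′ u) (T-∧-mono (S⊆S′ w) id)))
                             (allFin n))
            (allFin n)

Avoids-neighbours⇒nonadjacent : ∀ {n} (G : Graph n) v (S : Vec Bool n) →
  T (Avoids (neighbours G v) S) → ∀ w → T (not (lookup S w ∧ adj G v w))
Avoids-neighbours⇒nonadjacent {n} G v S avoids w with lookup S w in w∈S | adj G v w in vw
... | false | _     = tt
... | true  | false = tt
... | true  | true  = subst (T ∘ not) w∈S (T-allᵇ⁻ avoids w∈neighbours)
  where
  w∈neighbours : w ∈ neighbours G v
  w∈neighbours = ∈-filter⁺ (T? ∘ adj G v) (∈-allFin w) (subst T (sym vw) tt)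

isIndependent-insert : ∀ {n} (G : Graph n) v (S : Vec Bool n) →
  T (Avoids (neighbours G v) S) → T (isIndependent G S) → T (isIndependent G (S [ v ]≔ true))
isIndependent-insert G v S avoids S-independent = isIndependent⁺ G (S [ v ]≔ true) independent
  where
  nonadjacent : ∀ w → T (not (lookup S w ∧ adj G v w))
  nonadjacent = Avoids-neighbours⇒nonadjacent G v S avoids
  independent : ∀ u w → T (not (lookup (S [ v ]≔ true) u ∧ lookup (S [ v ]≔ true) w ∧ adj G u w))
  independent u w with u ≟ v | w ≟ v
  ... | yes refl | yes refl
    rewrite lookup∘update u S true | irrefl G u = tt
  ... | yes refl | no w≢v
    rewrite lookup∘update u S true | lookup∘update′ w≢v S true = nonadjacent w
  ... | no u≢v | yes refl
    rewrite lookup∘update w S true | lookup∘update′ u≢v S true | Graph.sym G u w = nonadjacent u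
  ... | no u≢v | no w≢v
    rewrite lookup∘update′ u≢v S true | lookup∘update′ w≢v S true =
      isIndependent⁻ G S S-independent u w

count-avoiding-closedNeighbourhood≤numIndepContaining : ∀ {n} (G : Graph n) v →
  count (λ S → Avoids (v ∷ neighbours G v) S ∧ isIndependent G S) (allSubsets n) ≤ numIndepContaining G v
count-avoiding-closedNeighbourhood≤numIndepContaining {n} G v = begin
  count (λ S → Avoids (v ∷ neighbours G v) S ∧ isIndependent G S) subsets
    ≤⟨ count-mono insert-v subsets ⟩
  count (λ S → not (lookup S v) ∧ isIndependent G (S [ v ]≔ true)) subsets
    ≡⟨ sym (count-∋≡count-∌-insert n v (isIndependent G)) ⟩
  count (λ S → lookup S v ∧ isIndependent G S) subsets
    ≡⟨ count-cong (λ S → ∧-comm (lookup S v) (isIndependent G S)) subsets ⟩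
  count (λ S → isIndependent G S ∧ lookup S v) subsets
    ≡⟨ sym (count-filterᵇ (isIndependent G) (λ S → lookup S v) subsets) ⟩
  numIndepContaining G v ∎
  where
  open ≤-Reasoning
  subsets : List (Vec Bool n)
  subsets = allSubsets n
  insert-v : ∀ S → T (Avoids (v ∷ neighbours G v) S ∧ isIndependent G S) →
             T (not (lookup S v) ∧ isIndependent G (S [ v ]≔ true))
  insert-v S h
    with avoids , S-independent ← Equivalence.to (T-∧ {Avoids (v ∷ neighbours G v) S}) h
    with v∉S , avoids-neighbours ← Equivalence.to (T-∧ {not (lookup S v)}) avoids
    = Equivalence.from T-∧ (v∉S , isIndependent-insert G v S avoids-neighbours S-independent)

lemma18 : ∀ {n} (G : Graph n) (d : ℕ) → HasMaxDegree G d →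
          (v : Fin n) → numIndep G ≤ 2 ^ suc d * numIndepContaining G v
lemma18 {n} G d (degree≤d , _) v = begin
  numIndep G
    ≤⟨ count-downwardClosed-avoiding (isIndependent-downwardClosed G) (v ∷ neighbours G v) ⟩
  2 ^ suc (degree G v) * count (λ S → Avoids (v ∷ neighbours G v) S ∧ isIndependent G S) (allSubsets n)
    ≤⟨ *-mono-≤ (^-monoʳ-≤ 2 (s≤s (degree≤d v))) (count-avoiding-closedNeighbourhood≤numIndepContaining G v) ⟩
  2 ^ suc d * numIndepContaining G v ∎
  where open ≤-Reasoning
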